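{- Let $n\ge 1$, let $G_n\in HL_n$, and let $i,j$ be positive integers with $i\le j$ and $i+j\le 2^n$. Then $e_{i+1}+e_j\le e_{i+j}$, where $e_g$ denotes the maximum number of edges of a subgraph of $G_n$ induced by $g$ vertices.
   Context: HL-networks are defined recursively: $HL_0=\{K_1\}$ and $HL_n=\{G_{n-1}\oplus G^*_{n-1} : G_{n-1},G^*_{n-1}\in HL_{n-1}\}$, where $G_{n-1}\oplus G^*_{n-1}$ denotes any graph obtained from the disjoint union of $G_{n-1}$ and $G^*_{n-1}$ by adding a perfect matching between their vertex sets. Each $G_n\in HL_n$ is $n$-regular with $2^n$ vertices. -}

module Defs where

open import Data.Nat using (ℕ; zero; suc; _+_; _<_; _≤_)
open import Data.Nat.Properties using (_<?_)
open import Data.Bool using (Bool; true; false; _∧_; if_then_else_)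
open import Data.Fin using (Fin; toℕ; splitAt; _≟_)
open import Data.Fin.Subset using (Subset; ∣_∣)
open import Data.Vec using (lookup)
open import Data.List using (List; map; allFin)
open import Data.Nat.ListAction using (sum)
open import Data.Sum using (_⊎_; inj₁; inj₂)
open import Data.Product using (Σ; _×_; _,_)
open import Function.Bundles using (_↔_; Inverse)
open import Relation.Nullary.Decidable using (⌊_⌋)
open import Relation.Binary.PropositionalEquality using (_≡_)

Graph : ℕ → Set
Graph m = Fin m → Fin m → Bool

K1 : Graph 1
K1 _ _ = false

-- G₁ ⊕_π G₂ : disjoint union on Fin (m + m) (left half = G₁, right half = G₂)
-- plus the perfect matching {u , π u} given by a bijection π.
matchJoin : ∀ {m} → Graph m → Graph m → (Fin m ↔ Fin m) → Graph (m + m)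
matchJoin {m} G₁ G₂ π u v with splitAt m u | splitAt m v
... | inj₁ a | inj₁ b = G₁ a b
... | inj₂ a | inj₂ b = G₂ a b
... | inj₁ a | inj₂ b = ⌊ Inverse.to π a ≟ b ⌋
... | inj₂ a | inj₁ b = ⌊ Inverse.to π b ≟ a ⌋

data HL : (n m : ℕ) → Graph m → Set where
  hl0 : (G : Graph 1) → (∀ u v → G u v ≡ K1 u v) → HL 0 1 G
  hlS : ∀ {n m} {G₁ G₂ : Graph m} (G : Graph (m + m)) →
        HL n m G₁ → HL n m G₂ → (π : Fin m ↔ Fin m) →
        (∀ u v → G u v ≡ matchJoin G₁ G₂ π u v) → HL (suc n) (m + m) G

-- number of edges of the subgraph of G induced by the vertex set S
-- (unordered pairs {u , v}, counted once via toℕ u < toℕ v)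
inducedEdges : ∀ {m} → Graph m → Subset m → ℕ
inducedEdges {m} G S =
  sum (map (λ u → sum (map (λ v →
    if ⌊ toℕ u <? toℕ v ⌋ ∧ lookup S u ∧ lookup S v ∧ G u v then 1 else 0)
    (allFin m))) (allFin m))

IsMaxInduced : ∀ {m} → Graph m → ℕ → ℕ → Set
IsMaxInduced {m} G g k =
  (Σ (Subset m) λ S → (∣ S ∣ ≡ g) × (inducedEdges G S ≡ k)) ×
  (∀ (S : Subset m) → ∣ S ∣ ≡ g → inducedEdges G S ≤ k)

module Submission where

-- Let h(g) = onesBelow g = Σ_{x<g} popcount(x), the number of edges spanned by the
-- first g vertices of the hypercube.  Induction along the HL structure shows e_g = h(g)
-- in every HL-network.  Upper bound: the matching joins a g₁-set and a g₂-set of the two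
-- halves by at most min(g₁, g₂) edges, and h(g₁) + h(g₂) + min(g₁, g₂) ≤ h(g₁ + g₂).
-- Lower bound: fill the first half before the second; an initial segment of size 2^k + r
-- spans at least h(2^k) + h(r) + r edges, which is h(2^k + r) because adding the top bit
-- raises every popcount below 2^k by one.  The theorem then reads
-- h(i+1) + h(j) ≤ h(i) + i + h(j) ≤ h(i+j).

open import Defs
open import Data.Nat using (ℕ; zero; suc; _+_; _∸_; _^_; _≤_; _<_; z≤n; s≤s; z<s)
open import Data.Nat.Properties hiding (_≟_)
open import Data.Nat.Induction using (<-rec)
open import Data.Nat.Tactic.RingSolver using (solve-∀)
open import Data.Nat.ListAction as List using ()
open import Algebra.Properties.CommutativeMonoid.Sum +-0-commutativeMonoid
  using (sum-syntax; sum-cong-≗; sum-replicate-zero; ∑-distrib-+; ∑-permute)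
open import Algebra.Properties.CommutativeSemigroup +-commutativeSemigroup using (xy∙z≈xz∙y)
open import Data.Bool using (Bool; true; false; _∧_; if_then_else_)
open import Data.Bool.Properties using (∧-assoc; ∧-zeroʳ; ∧-identityʳ)
open import Data.Fin using (Fin; zero; suc; toℕ; _≟_; _↑ˡ_; _↑ʳ_)
open import Data.Fin.Properties using (toℕ-↑ˡ; toℕ-↑ʳ; splitAt-↑ˡ; splitAt-↑ʳ; toℕ<n)
open import Data.Fin.Subset using (Subset; ∣_∣; ⊤; ⊥)
open import Data.Fin.Subset.Properties using (∣⊤∣≡n; ∣⊥∣≡0; ∣p∣≡n⇒p≡⊤)
open import Data.List using (List; []; _∷_; map; allFin; tabulate)
open import Data.List.Properties using (map-tabulate)
open import Data.Vec using ([]; _∷_; lookup; _++_; splitAt)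
open import Data.Vec.Properties using (lookup-++ˡ; lookup-++ʳ; lookup-replicate)
open import Data.Product using (Σ-syntax; _×_; _,_)
open import Data.Sum using (_⊎_; inj₁; inj₂)
open import Function.Bundles using (_↔_; Inverse; _⇔_; mk⇔)
open import Relation.Nullary using (Dec; yes; no; contradiction)
open import Relation.Nullary.Decidable using (⌊_⌋; ⌊⌋-map′; isYes≗does; does-⇔)
open import Relation.Binary.PropositionalEquality

-- Binary digit sums

inc : List Bool → List Bool
inc []           = true ∷ []
inc (false ∷ bs) = true ∷ bs
inc (true ∷ bs)  = false ∷ inc bs

-- little-endian binary expansion, without trailing zeros
binary : ℕ → List Bool
binary zero    = []
binary (suc n) = inc (binary n)

double : List Bool → List Bool
double []       = []
double (b ∷ bs) = false ∷ b ∷ bs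

ones : List Bool → ℕ
ones []           = 0
ones (true ∷ bs)  = suc (ones bs)
ones (false ∷ bs) = ones bs

popcount : ℕ → ℕ
popcount n = ones (binary n)

onesBelow : ℕ → ℕ
onesBelow zero    = 0
onesBelow (suc n) = onesBelow n + popcount n

binary-double : ∀ m → binary (m + m) ≡ double (binary m)
binary-double zero    = refl
binary-double (suc m) rewrite +-suc m m | binary-double m = inc-double (binary m)
  where
  inc-double : ∀ bs → inc (inc (double bs)) ≡ double (inc bs)
  inc-double []           = refl
  inc-double (false ∷ bs) = refl
  inc-double (true ∷ bs)  = refl

popcount-double : ∀ m → popcount (m + m) ≡ popcount m
popcount-double m rewrite binary-double m with binary m
... | []     = refl
... | _ ∷ _  = refl

popcount-suc-double : ∀ m → popcount (suc (m + m)) ≡ suc (popcount m)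
popcount-suc-double m rewrite binary-double m with binary m
... | []     = refl
... | _ ∷ _  = refl

popcount≤ : ∀ n → popcount n ≤ n
popcount≤ zero    = z≤n
popcount≤ (suc n) = ≤-trans (ones-inc (binary n)) (s≤s (popcount≤ n))
  where
  ones-inc : ∀ bs → ones (inc bs) ≤ suc (ones bs)
  ones-inc []           = ≤-refl
  ones-inc (false ∷ bs) = ≤-refl
  ones-inc (true ∷ bs)  = m≤n⇒m≤1+n (ones-inc bs)

popcount-suc-pos : ∀ n → 1 ≤ popcount (suc n)
popcount-suc-pos n = ones-inc-pos (binary n)
  where
  ones-inc-pos : ∀ bs → 1 ≤ ones (inc bs)
  ones-inc-pos []           = ≤-refl
  ones-inc-pos (false ∷ bs) = s≤s z≤n
  ones-inc-pos (true ∷ bs)  = ones-inc-pos bs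

onesBelow-suc-≤ : ∀ n → onesBelow (suc n) ≤ onesBelow n + n
onesBelow-suc-≤ n = +-monoʳ-≤ (onesBelow n) (popcount≤ n)

onesBelow-double : ∀ m → onesBelow (m + m) ≡ onesBelow m + onesBelow m + m
onesBelow-double zero    = refl
onesBelow-double (suc m)
  rewrite +-suc m m | popcount-suc-double m | popcount-double m | onesBelow-double m =
  rearrange (onesBelow m) (popcount m) m
  where
  rearrange : ∀ h p m → h + h + m + p + suc p ≡ h + p + (h + p) + suc m
  rearrange = solve-∀

onesBelow-suc-double : ∀ m → onesBelow (suc (m + m)) ≡ onesBelow m + onesBelow (suc m) + m
onesBelow-suc-double m rewrite popcount-double m | onesBelow-double m =
  rearrange (onesBelow m) (popcount m) m
  where
  rearrange : ∀ h p m → h + h + m + p ≡ h + (h + p) + m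
  rearrange = solve-∀

data Parity : ℕ → Set where
  even : ∀ p → Parity (p + p)
  odd  : ∀ p → Parity (suc (p + p))

parity : ∀ n → Parity n
parity zero = even 0
parity (suc n) with parity n
... | even p = odd p
... | odd p  = subst Parity (cong suc (+-suc p p)) (even (suc p))

half-≤ : ∀ {p q} → p + p ≤ suc (q + q) → p ≤ q
half-≤ {p} {q} h with p ≤? q
... | yes p≤q = p≤q
... | no p≰q  = contradiction h (<⇒≱ (<-≤-trans double-q< (+-mono-≤ q<p q<p)))
  where
  q<p = ≰⇒> p≰q
  double-q< : suc (q + q) < suc q + suc q
  double-q< = ≤-reflexive (cong suc (sym (+-suc q q)))

half-< : ∀ {p q} → suc (p + p) ≤ q + q → suc p ≤ q
half-< {p} {q} h = half-≤ (subst (_≤ suc (q + q)) (cong suc (sym (+-suc p p))) (s≤s h))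

Superadditive : ℕ → ℕ → Set
Superadditive a b = onesBelow a + onesBelow b + a ≤ onesBelow (a + b)

module _ (p q : ℕ) where
  open ≤-Reasoning

  superadditive-even-even : Superadditive p q → Superadditive (p + p) (q + q)
  superadditive-even-even hpq = begin
    h (p + p) + h (q + q) + (p + p)             ≡⟨ cong₂ (λ x y → x + y + (p + p)) (onesBelow-double p) (onesBelow-double q) ⟩
    (h p + h p + p) + (h q + h q + q) + (p + p) ≡⟨ rearrange (h p) (h q) p q ⟩
    (h p + h q + p) + (h p + h q + p) + (p + q) ≤⟨ +-monoˡ-≤ (p + q) (+-mono-≤ hpq hpq) ⟩
    h (p + q) + h (p + q) + (p + q)             ≡⟨ onesBelow-double (p + q) ⟨
    h ((p + q) + (p + q))                       ≡⟨ cong h (interchange p q) ⟩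
    h ((p + p) + (q + q))                       ∎
    where
    h = onesBelow
    rearrange : ∀ x y p q → (x + x + p) + (y + y + q) + (p + p) ≡ (x + y + p) + (x + y + p) + (p + q)
    rearrange = solve-∀
    interchange : ∀ p q → (p + q) + (p + q) ≡ (p + p) + (q + q)
    interchange = solve-∀

  superadditive-odd-even : Superadditive p q → Superadditive (suc p) q →
                           Superadditive (suc (p + p)) (q + q)
  superadditive-odd-even hpq hp′q = begin
    h (suc (p + p)) + h (q + q) + suc (p + p)             ≡⟨ cong₂ (λ x y → x + y + suc (p + p)) (onesBelow-suc-double p) (onesBelow-double q) ⟩
    (h p + h (suc p) + p) + (h q + h q + q) + suc (p + p) ≡⟨ rearrange (h p) (h (suc p)) (h q) p q ⟩
    (h p + h q + p) + (h (suc p) + h q + suc p) + (p + q) ≤⟨ +-monoˡ-≤ (p + q) (+-mono-≤ hpq hp′q) ⟩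
    h (p + q) + h (suc (p + q)) + (p + q)                 ≡⟨ onesBelow-suc-double (p + q) ⟨
    h (suc ((p + q) + (p + q)))                           ≡⟨ cong h (interchange p q) ⟩
    h (suc (p + p) + (q + q))                             ∎
    where
    h = onesBelow
    rearrange : ∀ x x′ y p q → (x + x′ + p) + (y + y + q) + (1 + (p + p)) ≡ (x + y + p) + (x′ + y + (1 + p)) + (p + q)
    rearrange = solve-∀
    interchange : ∀ p q → 1 + ((p + q) + (p + q)) ≡ (1 + (p + p)) + (q + q)
    interchange = solve-∀

  superadditive-even-odd : Superadditive p q → Superadditive p (suc q) →
                           Superadditive (p + p) (suc (q + q))
  superadditive-even-odd hpq hpq′ = begin
    h (p + p) + h (suc (q + q)) + (p + p)                 ≡⟨ cong₂ (λ x y → x + y + (p + p)) (onesBelow-double p) (onesBelow-suc-double q) ⟩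
    (h p + h p + p) + (h q + h (suc q) + q) + (p + p)     ≡⟨ rearrange (h p) (h q) (h (suc q)) p q ⟩
    (h p + h q + p) + (h p + h (suc q) + p) + (p + q)     ≤⟨ +-monoˡ-≤ (p + q) (+-mono-≤ hpq hpq′) ⟩
    h (p + q) + h (p + suc q) + (p + q)                   ≡⟨ cong (λ n → h (p + q) + h n + (p + q)) (+-suc p q) ⟩
    h (p + q) + h (suc (p + q)) + (p + q)                 ≡⟨ onesBelow-suc-double (p + q) ⟨
    h (suc ((p + q) + (p + q)))                           ≡⟨ cong h (interchange p q) ⟩
    h ((p + p) + suc (q + q))                             ∎
    where
    h = onesBelow
    rearrange : ∀ x y y′ p q → (x + x + p) + (y + y′ + q) + (p + p) ≡ (x + y + p) + (x + y′ + p) + (p + q)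
    rearrange = solve-∀
    interchange : ∀ p q → 1 + ((p + q) + (p + q)) ≡ (p + p) + (1 + (q + q))
    interchange = solve-∀

  -- The second hypothesis is weaker than Superadditive (suc p) q, which fails for p = q.
  superadditive-odd-odd : Superadditive p (suc q) →
                          onesBelow (suc p) + onesBelow q + p ≤ onesBelow (suc (p + q)) →
                          Superadditive (suc (p + p)) (suc (q + q))
  superadditive-odd-odd hpq′ hp′q = begin
    h (suc (p + p)) + h (suc (q + q)) + suc (p + p)             ≡⟨ cong₂ (λ x y → x + y + suc (p + p)) (onesBelow-suc-double p) (onesBelow-suc-double q) ⟩
    (h p + h (suc p) + p) + (h q + h (suc q) + q) + suc (p + p) ≡⟨ rearrange (h p) (h (suc p)) (h q) (h (suc q)) p q ⟩
    (h p + h (suc q) + p) + (h (suc p) + h q + p) + suc (p + q) ≤⟨ +-monoˡ-≤ (suc (p + q)) (+-mono-≤ hpq′ hp′q) ⟩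
    h (p + suc q) + h (suc (p + q)) + suc (p + q)               ≡⟨ cong (λ n → h n + h (suc (p + q)) + suc (p + q)) (+-suc p q) ⟩
    h (suc (p + q)) + h (suc (p + q)) + suc (p + q)             ≡⟨ onesBelow-double (suc (p + q)) ⟨
    h (suc (p + q) + suc (p + q))                               ≡⟨ cong h (interchange p q) ⟩
    h (suc (p + p) + suc (q + q))                               ∎
    where
    h = onesBelow
    rearrange : ∀ x x′ y y′ p q → (x + x′ + p) + (y + y′ + q) + (1 + (p + p)) ≡ (x + y′ + p) + (x′ + y + p) + (1 + (p + q))
    rearrange = solve-∀
    interchange : ∀ p q → (1 + (p + q)) + (1 + (p + q)) ≡ (1 + (p + p)) + (1 + (q + q))
    interchange = solve-∀

superadditive-one : ∀ b → 1 ≤ b → Superadditive 1 b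
superadditive-one (suc b) _ = +-monoʳ-≤ (onesBelow (suc b)) (popcount-suc-pos b)

onesBelow-superadditive : ∀ a b → a ≤ b → Superadditive a b
onesBelow-superadditive = <-rec (λ a → ∀ b → a ≤ b → Superadditive a b) step
  where
  step : ∀ a → (∀ {a′} → a′ < a → ∀ b → a′ ≤ b → Superadditive a′ b) →
         ∀ b → a ≤ b → Superadditive a b
  step a ih b a≤b with parity a | parity b
  ... | even zero    | _      = ≤-reflexive (+-identityʳ (onesBelow b))
  ... | odd zero     | _      = superadditive-one b a≤b
  ... | even (suc p) | even q = superadditive-even-even (suc p) q (ih half<a q (half-≤ (m≤n⇒m≤1+n a≤b)))
    where half<a = m<m+n (suc p) z<s
  ... | even (suc p) | odd q  =
    superadditive-even-odd (suc p) q (ih half<a q half≤q) (ih half<a (suc q) (m≤n⇒m≤1+n half≤q))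
    where
    half<a = m<m+n (suc p) z<s
    half≤q = half-≤ a≤b
  ... | odd (suc p)  | even q =
    superadditive-odd-even (suc p) q (ih half<a q (<⇒≤ half<q)) (ih half+1<a q half<q)
    where
    half<a   = s≤s (m≤m+n (suc p) (suc p))
    half+1<a = s≤s (m<m+n (suc p) z<s)
    half<q   = half-< a≤b
  ... | odd (suc p)  | odd q  =
    superadditive-odd-odd (suc p) q (ih half<a (suc q) (m≤n⇒m≤1+n half≤q)) (shifted (m≤n⇒m<n∨m≡n half≤q))
    where
    half<a   = s≤s (m≤m+n (suc p) (suc p))
    half+1<a = s≤s (m<m+n (suc p) z<s)
    half≤q   = half-≤ (m≤n⇒m≤1+n (≤-pred a≤b))
    shifted : suc p < q ⊎ suc p ≡ q →
              onesBelow (suc (suc p)) + onesBelow q + suc p ≤ onesBelow (suc (suc p + q))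
    shifted (inj₁ half<q) = ≤-trans (+-monoʳ-≤ _ (n≤1+n (suc p))) (ih half+1<a q half<q)
    shifted (inj₂ refl)   = ≤-reflexive (trans (cong (_+ suc p) (+-comm (onesBelow (suc (suc p))) _))
                                               (sym (onesBelow-suc-double (suc p))))

2^suc : ∀ k → 2 ^ suc k ≡ 2 ^ k + 2 ^ k
2^suc k = cong (2 ^ k +_) (+-identityʳ (2 ^ k))

popcount-2^k+ : ∀ k x → x < 2 ^ k → popcount (2 ^ k + x) ≡ suc (popcount x)
popcount-2^k+ zero    zero    _   = refl
popcount-2^k+ zero    (suc x) (s≤s ())
popcount-2^k+ (suc k) x       x<M rewrite 2^suc k with parity x
... | even s = begin
  popcount ((M + M) + (s + s)) ≡⟨ cong popcount (interchange M s) ⟩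
  popcount ((M + s) + (M + s)) ≡⟨ popcount-double (M + s) ⟩
  popcount (M + s)             ≡⟨ popcount-2^k+ k s (half-< x<M) ⟩
  suc (popcount s)             ≡⟨ cong suc (popcount-double s) ⟨
  suc (popcount (s + s))       ∎
  where
  M = 2 ^ k
  open ≡-Reasoning
  interchange : ∀ m s → (m + m) + (s + s) ≡ (m + s) + (m + s)
  interchange = solve-∀
... | odd s = begin
  popcount ((M + M) + suc (s + s)) ≡⟨ cong popcount (interchange M s) ⟩
  popcount (suc ((M + s) + (M + s))) ≡⟨ popcount-suc-double (M + s) ⟩
  suc (popcount (M + s))             ≡⟨ cong suc (popcount-2^k+ k s (half-< (≤-trans (n≤1+n _) x<M))) ⟩
  suc (suc (popcount s))             ≡⟨ cong suc (popcount-suc-double s) ⟨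
  suc (popcount (suc (s + s)))       ∎
  where
  M = 2 ^ k
  open ≡-Reasoning
  interchange : ∀ m s → (m + m) + suc (s + s) ≡ suc ((m + s) + (m + s))
  interchange = solve-∀

onesBelow-+ : ∀ N r → (∀ x → x < r → popcount (N + x) ≡ suc (popcount x)) →
              onesBelow (N + r) ≡ onesBelow N + onesBelow r + r
onesBelow-+ N zero    _     rewrite +-identityʳ N | +-identityʳ (onesBelow N) = sym (+-identityʳ (onesBelow N))
onesBelow-+ N (suc r) shift = begin
  onesBelow (N + suc r)                                      ≡⟨ cong onesBelow (+-suc N r) ⟩
  onesBelow (N + r) + popcount (N + r)                       ≡⟨ cong₂ _+_ (onesBelow-+ N r (λ x x<r → shift x (m<n⇒m<1+n x<r))) (shift r ≤-refl) ⟩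
  onesBelow N + onesBelow r + r + suc (popcount r)           ≡⟨ rearrange (onesBelow N) (onesBelow r) (popcount r) r ⟩
  onesBelow N + (onesBelow r + popcount r) + suc r           ∎
  where
  open ≡-Reasoning
  rearrange : ∀ n o p r → n + o + r + suc p ≡ n + (o + p) + suc r
  rearrange = solve-∀

onesBelow-2^k+ : ∀ k r → r ≤ 2 ^ k → onesBelow (2 ^ k + r) ≡ onesBelow (2 ^ k) + onesBelow r + r
onesBelow-2^k+ k r r≤2^k = onesBelow-+ (2 ^ k) r (λ x x<r → popcount-2^k+ k x (<-≤-trans x<r r≤2^k))

onesBelow-merge : ∀ a b c → c ≤ a → c ≤ b → onesBelow a + onesBelow b + c ≤ onesBelow (a + b)
onesBelow-merge a b c c≤a c≤b with ≤-total a b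
... | inj₁ a≤b = ≤-trans (+-monoʳ-≤ _ c≤a) (onesBelow-superadditive a b a≤b)
... | inj₂ b≤a = begin
  onesBelow a + onesBelow b + c ≡⟨ cong (_+ c) (+-comm (onesBelow a) (onesBelow b)) ⟩
  onesBelow b + onesBelow a + c ≤⟨ +-monoʳ-≤ _ c≤b ⟩
  onesBelow b + onesBelow a + b ≤⟨ onesBelow-superadditive b a b≤a ⟩
  onesBelow (b + a)             ≡⟨ cong onesBelow (+-comm b a) ⟩
  onesBelow (a + b)             ∎
  where open ≤-Reasoning

onesBelow-suc-+ : ∀ i j → i ≤ j → onesBelow (suc i) + onesBelow j ≤ onesBelow (i + j)
onesBelow-suc-+ i j i≤j = begin
  onesBelow (suc i) + onesBelow j ≤⟨ +-monoˡ-≤ _ (onesBelow-suc-≤ i) ⟩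
  onesBelow i + i + onesBelow j   ≡⟨ +-assoc (onesBelow i) i _ ⟩
  onesBelow i + (i + onesBelow j) ≡⟨ cong (onesBelow i +_) (+-comm i _) ⟩
  onesBelow i + (onesBelow j + i) ≡⟨ +-assoc (onesBelow i) _ i ⟨
  onesBelow i + onesBelow j + i   ≤⟨ onesBelow-superadditive i j i≤j ⟩
  onesBelow (i + j)               ∎
  where open ≤-Reasoning

-- Edge counts as finite sums

𝟙 : Bool → ℕ
𝟙 b = if b then 1 else 0

sum-allFin : ∀ {m} (h : Fin m → ℕ) → List.sum (map h (allFin m)) ≡ ∑[ i < m ] h i
sum-allFin {m} h = trans (cong List.sum (map-tabulate (λ i → i) h)) (sum-tabulate h)
  where
  sum-tabulate : ∀ {m} (h : Fin m → ℕ) → List.sum (tabulate h) ≡ ∑[ i < m ] h i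
  sum-tabulate {zero}  h = refl
  sum-tabulate {suc m} h = cong (h zero +_) (sum-tabulate (λ i → h (suc i)))

∑-mono-≤ : ∀ {m} {g h : Fin m → ℕ} → (∀ i → g i ≤ h i) → ∑[ i < m ] g i ≤ ∑[ i < m ] h i
∑-mono-≤ {zero}  _   = z≤n
∑-mono-≤ {suc m} g≤h = +-mono-≤ (g≤h zero) (∑-mono-≤ (λ i → g≤h (suc i)))

∑-↑ : ∀ m {n} (h : Fin (m + n) → ℕ) → ∑[ i < m + n ] h i ≡ ∑[ i < m ] h (i ↑ˡ n) + ∑[ j < n ] h (m ↑ʳ j)
∑-↑ zero    h = refl
∑-↑ (suc m) h = trans (cong (h zero +_) (∑-↑ m (λ i → h (suc i)))) (sym (+-assoc (h zero) _ _))

∑-sift : ∀ {m} (h : Fin m → Bool) (w : Fin m) → ∑[ v < m ] 𝟙 (h v ∧ ⌊ w ≟ v ⌋) ≡ 𝟙 (h w)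
∑-sift {suc m} h zero    = trans (cong₂ _+_ (cong 𝟙 (∧-identityʳ (h zero)))
  (trans (sum-cong-≗ (λ v → cong 𝟙 (∧-zeroʳ (h (suc v))))) (sum-replicate-zero m))) (+-identityʳ _)
∑-sift {suc m} h (suc w) = cong₂ _+_ (cong 𝟙 (∧-zeroʳ (h zero)))
  (trans (sum-cong-≗ (λ v → cong (λ b → 𝟙 (h (suc v) ∧ b)) (⌊⌋-map′ _ _ (w ≟ v)))) (∑-sift (λ v → h (suc v)) w))

∣S∣≡∑ : ∀ {m} (S : Subset m) → ∣ S ∣ ≡ ∑[ u < m ] 𝟙 (lookup S u)
∣S∣≡∑ []          = refl
∣S∣≡∑ (true ∷ S)  = cong suc (∣S∣≡∑ S)
∣S∣≡∑ (false ∷ S) = ∣S∣≡∑ S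

∣++∣ : ∀ {m n} (xs : Subset m) (ys : Subset n) → ∣ xs ++ ys ∣ ≡ ∣ xs ∣ + ∣ ys ∣
∣++∣ []           ys = refl
∣++∣ (true ∷ xs)  ys = cong suc (∣++∣ xs ys)
∣++∣ (false ∷ xs) ys = ∣++∣ xs ys

⌊⌋-⇔ : ∀ {A B : Set} → A ⇔ B → (a? : Dec A) (b? : Dec B) → ⌊ a? ⌋ ≡ ⌊ b? ⌋
⌊⌋-⇔ A⇔B a? b? = trans (isYes≗does a?) (trans (does-⇔ A⇔B a? b?) (sym (isYes≗does b?)))

𝟙-∧-≤ˡ : ∀ x y → 𝟙 (x ∧ y) ≤ 𝟙 x
𝟙-∧-≤ˡ true  true  = ≤-refl
𝟙-∧-≤ˡ true  false = z≤n
𝟙-∧-≤ˡ false _     = z≤n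

𝟙-∧-≤ʳ : ∀ x y → 𝟙 (x ∧ y) ≤ 𝟙 y
𝟙-∧-≤ʳ true  y = ≤-refl
𝟙-∧-≤ʳ false y = z≤n

edge : ∀ {m} → Graph m → Subset m → Fin m → Fin m → ℕ
edge G S u v = 𝟙 (⌊ toℕ u <? toℕ v ⌋ ∧ lookup S u ∧ lookup S v ∧ G u v)

edges : ∀ {m} → Graph m → Subset m → ℕ
edges {m} G S = ∑[ u < m ] ∑[ v < m ] edge G S u v

inducedEdges≡edges : ∀ {m} (G : Graph m) (S : Subset m) → inducedEdges G S ≡ edges G S
inducedEdges≡edges {m} G S =
  trans (sum-allFin (λ u → List.sum (map (edge G S u) (allFin m)))) (sum-cong-≗ (λ u → sum-allFin (edge G S u)))

edges-cong : ∀ {m} {G H : Graph m} → (∀ u v → G u v ≡ H u v) → ∀ S → edges G S ≡ edges H S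
edges-cong G≡H S = sum-cong-≗ (λ u → sum-cong-≗ (λ v →
  cong (λ b → 𝟙 (⌊ toℕ u <? toℕ v ⌋ ∧ lookup S u ∧ lookup S v ∧ b)) (G≡H u v)))

module Matching {m} (G₁ G₂ : Graph m) (π : Fin m ↔ Fin m) where
  open Inverse π using (to)

  matched : Subset m → Subset m → ℕ
  matched xs ys = ∑[ a < m ] 𝟙 (lookup xs a ∧ lookup ys (to a))

  matched≤ˡ : ∀ xs ys → matched xs ys ≤ ∣ xs ∣
  matched≤ˡ xs ys = ≤-trans (∑-mono-≤ (λ a → 𝟙-∧-≤ˡ (lookup xs a) (lookup ys (to a)))) (≤-reflexive (sym (∣S∣≡∑ xs)))

  ∑-matched : ∀ ys → ∑[ a < m ] 𝟙 (lookup ys (to a)) ≡ ∣ ys ∣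
  ∑-matched ys = trans (sym (∑-permute (λ b → 𝟙 (lookup ys b)) π)) (sym (∣S∣≡∑ ys))

  matched≤ʳ : ∀ xs ys → matched xs ys ≤ ∣ ys ∣
  matched≤ʳ xs ys = ≤-trans (∑-mono-≤ (λ a → 𝟙-∧-≤ʳ (lookup xs a) (lookup ys (to a)))) (≤-reflexive (∑-matched ys))

  matched-⊤ : ∀ ys → matched ⊤ ys ≡ ∣ ys ∣
  matched-⊤ ys = trans (sum-cong-≗ (λ a → cong (λ x → 𝟙 (x ∧ lookup ys (to a))) (lookup-replicate a true))) (∑-matched ys)

  module _ (xs ys : Subset m) where
    private
      G = matchJoin G₁ G₂ π
      S = xs ++ ys

    edge-↑ˡ↑ˡ : ∀ a b → edge G S (a ↑ˡ m) (b ↑ˡ m) ≡ edge G₁ xs a b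
    edge-↑ˡ↑ˡ a b rewrite toℕ-↑ˡ a m | toℕ-↑ˡ b m | lookup-++ˡ xs ys a | lookup-++ˡ xs ys b
      | splitAt-↑ˡ m a m | splitAt-↑ˡ m b m = refl

    edge-↑ʳ↑ʳ : ∀ a b → edge G S (m ↑ʳ a) (m ↑ʳ b) ≡ edge G₂ ys a b
    edge-↑ʳ↑ʳ a b rewrite toℕ-↑ʳ m a | toℕ-↑ʳ m b | lookup-++ʳ xs ys a | lookup-++ʳ xs ys b
      | splitAt-↑ʳ m m a | splitAt-↑ʳ m m b
      | ⌊⌋-⇔ (mk⇔ (+-cancelˡ-< m _ _) (+-monoʳ-< m)) (m + toℕ a <? m + toℕ b) (toℕ a <? toℕ b) = refl

    edge-↑ˡ↑ʳ : ∀ a b → edge G S (a ↑ˡ m) (m ↑ʳ b) ≡ 𝟙 ((lookup xs a ∧ lookup ys b) ∧ ⌊ to a ≟ b ⌋)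
    edge-↑ˡ↑ʳ a b rewrite toℕ-↑ˡ a m | toℕ-↑ʳ m b | lookup-++ˡ xs ys a | lookup-++ʳ xs ys b
      | splitAt-↑ˡ m a m | splitAt-↑ʳ m m b | ∧-assoc (lookup xs a) (lookup ys b) ⌊ to a ≟ b ⌋
      with toℕ a <? m + toℕ b
    ... | yes _   = refl
    ... | no a≮b = contradiction (≤-trans (toℕ<n a) (m≤m+n m (toℕ b))) a≮b

    edge-↑ʳ↑ˡ : ∀ a b → edge G S (m ↑ʳ a) (b ↑ˡ m) ≡ 0
    edge-↑ʳ↑ˡ a b rewrite toℕ-↑ʳ m a | toℕ-↑ˡ b m with m + toℕ a <? toℕ b
    ... | no _    = refl
    ... | yes b<a = contradiction (≤-trans (m≤m+n m (toℕ a)) (<⇒≤ b<a)) (<⇒≱ (toℕ<n b))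

    edges-matchJoin : edges G S ≡ edges G₁ xs + edges G₂ ys + matched xs ys
    edges-matchJoin = begin
      ∑[ u < m + m ] ∑[ v < m + m ] e u v
        ≡⟨ ∑-↑ m (λ u → ∑[ v < m + m ] e u v) ⟩
      ∑[ a < m ] ∑[ v < m + m ] e (a ↑ˡ m) v + ∑[ a < m ] ∑[ v < m + m ] e (m ↑ʳ a) v
        ≡⟨ cong₂ _+_ (sum-cong-≗ (λ a → ∑-↑ m (e (a ↑ˡ m)))) (sum-cong-≗ (λ a → ∑-↑ m (e (m ↑ʳ a)))) ⟩
      ∑[ a < m ] (∑[ b < m ] e (a ↑ˡ m) (b ↑ˡ m) + ∑[ b < m ] e (a ↑ˡ m) (m ↑ʳ b)) +
      ∑[ a < m ] (∑[ b < m ] e (m ↑ʳ a) (b ↑ˡ m) + ∑[ b < m ] e (m ↑ʳ a) (m ↑ʳ b))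
        ≡⟨ cong₂ _+_ (sum-cong-≗ left) (sum-cong-≗ right) ⟩
      ∑[ a < m ] (∑[ b < m ] edge G₁ xs a b + 𝟙 (lookup xs a ∧ lookup ys (to a))) + edges G₂ ys
        ≡⟨ cong (_+ edges G₂ ys) (∑-distrib-+ (λ a → ∑[ b < m ] edge G₁ xs a b) _) ⟩
      edges G₁ xs + matched xs ys + edges G₂ ys
        ≡⟨ xy∙z≈xz∙y (edges G₁ xs) _ _ ⟩
      edges G₁ xs + edges G₂ ys + matched xs ys ∎
      where
      open ≡-Reasoning
      e = edge G S
      left : ∀ a → ∑[ b < m ] e (a ↑ˡ m) (b ↑ˡ m) + ∑[ b < m ] e (a ↑ˡ m) (m ↑ʳ b) ≡
                   ∑[ b < m ] edge G₁ xs a b + 𝟙 (lookup xs a ∧ lookup ys (to a))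
      left a = cong₂ _+_ (sum-cong-≗ (edge-↑ˡ↑ˡ a))
                         (trans (sum-cong-≗ (edge-↑ˡ↑ʳ a)) (∑-sift (λ b → lookup xs a ∧ lookup ys b) (to a)))
      right : ∀ a → ∑[ b < m ] e (m ↑ʳ a) (b ↑ˡ m) + ∑[ b < m ] e (m ↑ʳ a) (m ↑ʳ b) ≡
                    ∑[ b < m ] edge G₂ ys a b
      right a = cong₂ _+_ (trans (sum-cong-≗ (edge-↑ʳ↑ˡ a)) (sum-replicate-zero m)) (sum-cong-≗ (edge-↑ʳ↑ʳ a))

open Matching using (matched; matched≤ˡ; matched≤ʳ; matched-⊤; edges-matchJoin)

edges-join : ∀ {m} {G₁ G₂ : Graph m} {π : Fin m ↔ Fin m} {G : Graph (m + m)} →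
             (∀ u v → G u v ≡ matchJoin G₁ G₂ π u v) →
             ∀ xs ys → edges G (xs ++ ys) ≡ edges G₁ xs + edges G₂ ys + matched G₁ G₂ π xs ys
edges-join {G₁ = G₁} {G₂} {π} G≡ xs ys = trans (edges-cong G≡ (xs ++ ys)) (edges-matchJoin G₁ G₂ π xs ys)

-- Extremal edge counts in HL-networks

HL-size : ∀ {n m} {G : Graph m} → HL n m G → m ≡ 2 ^ n
HL-size (hl0 _ _)                 = refl
HL-size (hlS {n} _ h₁ _ _ _) = trans (cong (λ k → k + k) (HL-size h₁)) (sym (2^suc n))

edges≤onesBelow : ∀ {n m} {G : Graph m} → HL n m G → ∀ S → edges G S ≤ onesBelow ∣ S ∣
-- With one vertex there is no pair u < v, so edges G S computes to 0.
edges≤onesBelow (hl0 _ _) S = z≤n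
edges≤onesBelow (hlS {m = m} {G₁} {G₂} G h₁ h₂ π G≡) S with splitAt m S
... | xs , ys , refl = begin
  edges G (xs ++ ys)                                 ≡⟨ edges-join G≡ xs ys ⟩
  edges G₁ xs + edges G₂ ys + matched G₁ G₂ π xs ys  ≤⟨ +-monoˡ-≤ _ (+-mono-≤ (edges≤onesBelow h₁ xs) (edges≤onesBelow h₂ ys)) ⟩
  onesBelow ∣ xs ∣ + onesBelow ∣ ys ∣ + matched G₁ G₂ π xs ys
    ≤⟨ onesBelow-merge ∣ xs ∣ ∣ ys ∣ _ (matched≤ˡ G₁ G₂ π xs ys) (matched≤ʳ G₁ G₂ π xs ys) ⟩
  onesBelow (∣ xs ∣ + ∣ ys ∣)                        ≡⟨ cong onesBelow (∣++∣ xs ys) ⟨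
  onesBelow ∣ xs ++ ys ∣                             ∎
  where open ≤-Reasoning

onesBelow≤edges : ∀ {n m} {G : Graph m} → HL n m G → ∀ g → g ≤ m →
                  Σ[ S ∈ Subset m ] ∣ S ∣ ≡ g × onesBelow g ≤ edges G S
onesBelow≤edges (hl0 _ _) zero          _         = false ∷ [] , refl , z≤n
onesBelow≤edges (hl0 _ _) (suc zero)    _         = true ∷ [] , refl , z≤n
onesBelow≤edges (hl0 _ _) (suc (suc _)) (s≤s ())
onesBelow≤edges (hlS {n} {m}  {G₁} {G₂} G h₁ h₂ π G≡) g g≤2m with g ≤? m
... | yes g≤m =
  let S₁ , ∣S₁∣≡g , ≤E₁ = onesBelow≤edges h₁ g g≤m in
  S₁ ++ ⊥ ,
  trans (∣++∣ S₁ ⊥) (trans (cong₂ _+_ ∣S₁∣≡g (∣⊥∣≡0 m)) (+-identityʳ g)) ,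
  (begin
    onesBelow g                                     ≤⟨ ≤E₁ ⟩
    edges G₁ S₁                                     ≤⟨ m≤m+n _ _ ⟩
    edges G₁ S₁ + edges G₂ ⊥                        ≤⟨ m≤m+n _ _ ⟩
    edges G₁ S₁ + edges G₂ ⊥ + matched G₁ G₂ π S₁ ⊥ ≡⟨ edges-join G≡ S₁ ⊥ ⟨
    edges G (S₁ ++ ⊥)                               ∎)
  where open ≤-Reasoning
... | no g≰m =
  let S₁ , ∣S₁∣≡m , ≤E₁ = onesBelow≤edges h₁ m ≤-refl
      S₂ , ∣S₂∣≡r , ≤E₂ = onesBelow≤edges h₂ r r≤m
      ≤E⊤ : onesBelow m ≤ edges G₁ ⊤
      ≤E⊤ = subst (λ S → onesBelow m ≤ edges G₁ S) (∣p∣≡n⇒p≡⊤ {p = S₁} ∣S₁∣≡m) ≤E₁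
      r≡matched : r ≡ matched G₁ G₂ π ⊤ S₂
      r≡matched = trans (sym ∣S₂∣≡r) (sym (matched-⊤ G₁ G₂ π S₂))
  in
  ⊤ ++ S₂ ,
  trans (∣++∣ (⊤ {m}) S₂) (trans (cong₂ _+_ (∣⊤∣≡n m) ∣S₂∣≡r) (m+[n∸m]≡n m≤g)) ,
  (begin
    onesBelow g                                       ≡⟨ cong onesBelow (m+[n∸m]≡n m≤g) ⟨
    onesBelow (m + r)                                 ≡⟨ onesBelow-top-half ⟩
    onesBelow m + onesBelow r + r                     ≤⟨ +-mono-≤ (+-mono-≤ ≤E⊤ ≤E₂) (≤-reflexive r≡matched) ⟩
    edges G₁ ⊤ + edges G₂ S₂ + matched G₁ G₂ π ⊤ S₂   ≡⟨ edges-join G≡ ⊤ S₂ ⟨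
    edges G (⊤ ++ S₂)                                 ∎)
  where
  open ≤-Reasoning
  r = g ∸ m
  m≤g = <⇒≤ (≰⇒> g≰m)
  r≤m : r ≤ m
  r≤m = ≤-trans (∸-monoˡ-≤ m g≤2m) (≤-reflexive (m+n∸m≡n m m))
  onesBelow-top-half : onesBelow (m + r) ≡ onesBelow m + onesBelow r + r
  onesBelow-top-half = subst (λ M → r ≤ M → onesBelow (M + r) ≡ onesBelow M + onesBelow r + r)
                             (sym (HL-size h₁)) (onesBelow-2^k+ n r) r≤m

maxInduced≡onesBelow : ∀ {n m} {G : Graph m} → HL n m G → ∀ {g k} → g ≤ m → IsMaxInduced G g k → k ≡ onesBelow g
maxInduced≡onesBelow h {g} {k} g≤m ((S , ∣S∣≡g , S-edges) , maximal) = ≤-antisym upper lower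
  where
  open ≤-Reasoning
  upper : k ≤ onesBelow g
  upper = begin
    k                  ≡⟨ S-edges ⟨
    inducedEdges _ S   ≡⟨ inducedEdges≡edges _ S ⟩
    edges _ S          ≤⟨ edges≤onesBelow h S ⟩
    onesBelow ∣ S ∣    ≡⟨ cong onesBelow ∣S∣≡g ⟩
    onesBelow g        ∎
  lower : onesBelow g ≤ k
  lower with onesBelow≤edges h g g≤m
  ... | T , ∣T∣≡g , ≤E = ≤-trans ≤E (≤-trans (≤-reflexive (sym (inducedEdges≡edges _ T))) (maximal T ∣T∣≡g))

lemma2p5 : (n : ℕ) → 1 ≤ n → (G : Graph (2 ^ n)) → HL n (2 ^ n) G →
    (i j : ℕ) → 1 ≤ i → i ≤ j → i + j ≤ 2 ^ n →
    (a b c : ℕ) → IsMaxInduced G (i + 1) a → IsMaxInduced G j b →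
    IsMaxInduced G (i + j) c → a + b ≤ c
lemma2p5 n _ G hl i j 1≤i i≤j i+j≤2^n a b c max-a max-b max-c = begin
  a + b                           ≡⟨ cong₂ _+_ (maxInduced≡onesBelow hl i+1≤2^n max-a) (maxInduced≡onesBelow hl j≤2^n max-b) ⟩
  onesBelow (i + 1) + onesBelow j ≡⟨ cong (λ x → onesBelow x + onesBelow j) (+-comm i 1) ⟩
  onesBelow (suc i) + onesBelow j ≤⟨ onesBelow-suc-+ i j i≤j ⟩
  onesBelow (i + j)               ≡⟨ maxInduced≡onesBelow hl i+j≤2^n max-c ⟨
  c                               ∎
  where
  open ≤-Reasoning
  i+1≤2^n = ≤-trans (+-monoʳ-≤ i (≤-trans 1≤i i≤j)) i+j≤2^n
  j≤2^n = ≤-trans (m≤n+m j i) i+j≤2^n
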